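{- Let $G$ be a connected non-bipartite graph, $M$ its edge-node incidence matrix and $\sigma(x) := \mathbf{1} - Mx$ for $x \in \mathbb{R}^{V(G)}$. Then \[\sigma(\mathbb{R}^{V(G)}) = \{y \in \mathbb{R}^{E(G)} \mid \omega_W(y) = 0 \text{ for all even closed walks } W \text{ in } G\}.\]
   Context: A walk is a sequence $W=(v_0,e_1,v_1,\dots,e_\ell,v_\ell)$ where $e_i$ has ends $v_{i-1},v_i$; it is closed if $v_0=v_\ell$ and even if $\ell$ is even. For $y\in\mathbb{R}^{E(G)}$, $\omega_W(y) := \sum_{i=1}^\ell (-1)^{i-1} y(e_i)$. -}

module Defs where

open import Level using (Level; _⊔_; suc)
import Data.Nat
open import Data.Nat using (ℕ; zero) renaming (suc to sucℕ)
open import Data.Fin using (Fin)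
open import Data.Bool using (Bool)
open import Data.Product using (Σ; _×_; _,_; proj₁; proj₂; ∃)
open import Data.Sum using (_⊎_)
open import Relation.Nullary using (¬_)
open import Relation.Binary.PropositionalEquality using (_≡_)
open import Algebra.Bundles using (CommutativeRing)

natCast : ∀ {c ℓ} (R : CommutativeRing c ℓ) → ℕ → CommutativeRing.Carrier R
natCast R zero     = CommutativeRing.0# R
natCast R (sucℕ n) = CommutativeRing._+_ R (CommutativeRing.1# R) (natCast R n)

-- Scalars: a field of characteristic zero (ℝ is an instance).
record CharZeroField (c ℓ : Level) : Set (Level.suc (c ⊔ ℓ)) where
  field
    cring : CommutativeRing c ℓ
  open CommutativeRing cring public

  field
    nontrivial : ¬ (1# ≈ 0#)
    inverse    : ∀ x → ¬ (x ≈ 0#) → Σ Carrier (λ y → x * y ≈ 1#)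
    charZero   : ∀ (n : ℕ) → ¬ (natCast cring (sucℕ n) ≈ 0#)

record Graph : Set where
  field
    nV   : ℕ
    nE   : ℕ
    end₁ : Fin nE → Fin nV
    end₂ : Fin nE → Fin nV
    loopless : ∀ e → ¬ (end₁ e ≡ end₂ e)

module _ (G : Graph) where
  open Graph G

  Joins : Fin nE → Fin nV → Fin nV → Set
  Joins e u v = (end₁ e ≡ u × end₂ e ≡ v) ⊎ (end₁ e ≡ v × end₂ e ≡ u)

  data Walk : Fin nV → Fin nV → Set where
    [_]  : ∀ v → Walk v v
    step : ∀ {u w v} (e : Fin nE) → Joins e u w → Walk w v → Walk u v

  length : ∀ {u v} → Walk u v → ℕ
  length [ _ ]          = zero
  length (step _ _ W)   = sucℕ (length W)

  EvenWalk : ∀ {u v} → Walk u v → Set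
  EvenWalk W = Σ ℕ λ k → length W ≡ k Data.Nat.+ k

  Connected : Set
  Connected = ∀ u v → Walk u v

  Bipartite : Set
  Bipartite = Σ (Fin nV → Bool) λ c → ∀ e → ¬ (c (end₁ e) ≡ c (end₂ e))

  module _ {c ℓ} (F : CharZeroField c ℓ) where
    open CharZeroField F

    -- ω_W(y) = Σ_{i=1}^ℓ (-1)^{i-1} y(e_i)
    ω : ∀ {u v} → Walk u v → (Fin nE → Carrier) → Carrier
    ω [ _ ]          y = 0#
    ω (step e _ W)   y = y e - ω W y

    -- (M x)(e) = Σ_v M_{e,v} x(v) = x(end₁ e) + x(end₂ e)  (edge-node incidence matrix)
    Mmul : (Fin nV → Carrier) → (Fin nE → Carrier)
    Mmul x e = x (end₁ e) + x (end₂ e)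

    σ : (Fin nV → Carrier) → (Fin nE → Carrier)
    σ x e = 1# - Mmul x e

    InImageσ : (Fin nE → Carrier) → Set (c ⊔ ℓ)
    InImageσ y = Σ (Fin nV → Carrier) λ x → ∀ e → y e ≈ σ x e

    EvenClosedWalkCondition : (Fin nE → Carrier) → Set ℓ
    EvenClosedWalkCondition y = ∀ v (W : Walk v v) → EvenWalk W → ω W y ≈ 0#

-- If y = σ x, the alternating sum along an even walk from u to v telescopes
-- (two consecutive edges u–w–t contribute x t − x u) to x v − x u, which vanishes on
-- closed walks. Conversely, in a connected non-bipartite graph every vertex v lies on
-- an odd closed walk O_v: colour u by the parity of a walk from v to u; a
-- monochromatic edge closes an odd cycle. If y = σ x then ω_{O_v}(y) = 1 − 2 x v, so
-- one puts x v := (1 − ω_{O_v}(y)) / 2. For an edge e = ab the closed walk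
-- O_a e O_b e is even, and the hypothesis ω = 0 on it reads
-- (ω_{O_a}(y) − y e) + (ω_{O_b}(y) − y e) = 0, which is exactly y e = 1 − x a − x b.
module Submission where

open import Defs
open import Level using (Level)
open import Data.Fin using (Fin)
open import Relation.Nullary using (¬_)
open import Function.Bundles using (_⇔_; mk⇔)

open import Algebra.Bundles using (AbelianGroup; Ring)
open import Data.Bool using (Bool; true; false; not; _xor_; _≟_)
open import Data.Bool.Properties using (not-involutive; not-distribˡ-xor; not-distribʳ-xor; xor-same)
open import Data.Fin.Properties using (¬∀⟶∃¬)
open import Data.Nat using (ℕ; zero; suc)
open import Data.Product using (Σ-syntax; ∃-syntax; _,_; proj₁; proj₂)
open import Data.Sum using (inj₁; inj₂; swap)
open import Relation.Nullary using (¬?)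
open import Relation.Nullary.Decidable using (decidable-stable)
open import Relation.Binary.PropositionalEquality as ≡ using (_≡_; refl)

module Parity where
  open import Data.Nat using (_+_)
  open import Data.Nat.Properties using (+-suc)
  open ≡ using (sym; trans; cong)

  isOdd : ℕ → Bool
  isOdd zero    = false
  isOdd (suc n) = not (isOdd n)

  isOdd-+ : ∀ m n → isOdd (m + n) ≡ isOdd m xor isOdd n
  isOdd-+ zero    n = refl
  isOdd-+ (suc m) n = trans (cong not (isOdd-+ m n)) (not-distribˡ-xor (isOdd m) (isOdd n))

  isOdd-double : ∀ k → isOdd (k + k) ≡ false
  isOdd-double k = trans (isOdd-+ k k) (xor-same (isOdd k))

  isOdd≡false⇒double : ∀ n → isOdd n ≡ false → ∃[ k ] n ≡ k + k
  isOdd≡false⇒double zero          _ = 0 , refl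
  isOdd≡false⇒double (suc (suc n)) even
    with isOdd≡false⇒double n (trans (sym (not-involutive (isOdd n))) even)
  ... | k , refl = suc k , cong suc (sym (+-suc k k))

open Parity

module AbelianGroupLemmas {a ℓ} (A : AbelianGroup a ℓ) where
  open AbelianGroup A renaming (_∙_ to infixl 6 _+_; _⁻¹ to infix 8 -_; ε to 0#; refl to ≈-refl)
  open import Algebra.Properties.AbelianGroup A using (⁻¹-anti-homo‿-; ⁻¹-∙-comm; ε⁻¹≈ε)
  open import Algebra.Solver.CommutativeMonoid commutativeMonoid using (solve; _⊕_; _⊜_)
  open import Relation.Binary.Reasoning.Setoid setoid

  +-cancelʳ : ∀ u x → u + (x - x) ≈ u
  +-cancelʳ u x = trans (∙-congˡ (inverseʳ x)) (identityʳ u)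

  x-0≈x : ∀ x → x - 0# ≈ x
  x-0≈x x = trans (∙-congˡ ε⁻¹≈ε) (identityʳ x)

  x-[y-z]≈x-y+z : ∀ x y z → x - (y - z) ≈ x - y + z
  x-[y-z]≈x-y+z x y z = begin
    x - (y - z)  ≈⟨ ∙-congˡ (⁻¹-anti-homo‿- y z) ⟩
    x + (z - y)  ≈⟨ solve 3 (λ x z ny → (x ⊕ (z ⊕ ny)) ⊜ ((x ⊕ ny) ⊕ z)) ≈-refl x z (- y) ⟩
    x - y + z    ∎

  x-[y+z]≈x-y-z : ∀ x y z → x - (y + z) ≈ x - y - z
  x-[y+z]≈x-y-z x y z = trans (∙-congˡ (sym (⁻¹-∙-comm y z))) (sym (assoc x (- y) (- z)))

  x-[x-y]≈y : ∀ x y → x - (x - y) ≈ y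
  x-[x-y]≈y x y = begin
    x - (x - y)   ≈⟨ ∙-congˡ (⁻¹-anti-homo‿- x y) ⟩
    x + (y - x)   ≈⟨ solve 3 (λ x y nx → (x ⊕ (y ⊕ nx)) ⊜ (y ⊕ (x ⊕ nx))) ≈-refl x y (- x) ⟩
    y + (x - x)   ≈⟨ +-cancelʳ y x ⟩
    y             ∎

  [x-y]+[z-x]≈z-y : ∀ x y z → (x - y) + (z - x) ≈ z - y
  [x-y]+[z-x]≈z-y x y z = begin
    (x - y) + (z - x)   ≈⟨ solve 4 (λ x ny z nx → ((x ⊕ ny) ⊕ (z ⊕ nx)) ⊜ ((z ⊕ ny) ⊕ (x ⊕ nx))) ≈-refl x (- y) z (- x) ⟩
    (z - y) + (x - x)   ≈⟨ +-cancelʳ (z - y) x ⟩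
    z - y               ∎

  [x-y]-[x-z]≈z-y : ∀ x y z → (x - y) - (x - z) ≈ z - y
  [x-y]-[x-z]≈z-y x y z = trans (∙-congˡ (⁻¹-anti-homo‿- x z)) ([x-y]+[z-x]≈z-y x y z)

  [x+y]-[z+x]≈y-z : ∀ x y z → (x + y) - (z + x) ≈ y - z
  [x+y]-[z+x]≈y-z x y z = begin
    (x + y) - (z + x)      ≈⟨ ∙-congˡ (sym (⁻¹-∙-comm z x)) ⟩
    (x + y) + (- z - x)    ≈⟨ solve 4 (λ x y nz nx → ((x ⊕ y) ⊕ (nz ⊕ nx)) ⊜ ((y ⊕ nz) ⊕ (x ⊕ nx))) ≈-refl x y (- z) (- x) ⟩
    (y - z) + (x - x)      ≈⟨ +-cancelʳ (y - z) x ⟩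
    y - z                  ∎

  -- The vanishing sum supplies exactly the terms a and b that cancel − a and − b.
  balanced-sum : ∀ {x a b t} → (a - t) + (b - t) ≈ 0# → (x - a) + (x - b) ≈ (x - t) + (x - t)
  balanced-sum {x} {a} {b} {t} vanishes = begin
    (x - a) + (x - b)                                ≈⟨ identityʳ _ ⟨
    (x - a) + (x - b) + 0#                           ≈⟨ ∙-congˡ vanishes ⟨
    (x - a) + (x - b) + ((a - t) + (b - t))          ≈⟨ solve 6 (λ x na nb a nt b →
         (((x ⊕ na) ⊕ (x ⊕ nb)) ⊕ ((a ⊕ nt) ⊕ (b ⊕ nt))) ⊜ ((((x ⊕ nt) ⊕ (x ⊕ nt)) ⊕ (b ⊕ nb)) ⊕ (a ⊕ na)))
         ≈-refl x (- a) (- b) a (- t) b ⟩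
    (x - t) + (x - t) + (b - b) + (a - a)            ≈⟨ +-cancelʳ _ a ⟩
    (x - t) + (x - t) + (b - b)                      ≈⟨ +-cancelʳ _ b ⟩
    (x - t) + (x - t)                                ∎

module RingLemmas {r ℓ} (R : Ring r ℓ) where
  open Ring R renaming (refl to ≈-refl)
  open AbelianGroupLemmas +-abelianGroup using (x-[x-y]≈y; balanced-sum)
  open import Relation.Binary.Reasoning.Setoid setoid

  halving : ∀ {h t a b} → h + h ≈ 1# → (a - t) + (b - t) ≈ 0# →
            1# - (h * (1# - a) + h * (1# - b)) ≈ t
  halving {h} {t} {a} {b} h+h≈1 vanishes = begin
    1# - (h * (1# - a) + h * (1# - b))      ≈⟨ +-congˡ (-‿cong halves-sum) ⟩
    1# - (1# - t)                           ≈⟨ x-[x-y]≈y 1# t ⟩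
    t                                       ∎
    where
    halves-sum : h * (1# - a) + h * (1# - b) ≈ 1# - t
    halves-sum = begin
      h * (1# - a) + h * (1# - b)           ≈⟨ distribˡ h _ _ ⟨
      h * ((1# - a) + (1# - b))             ≈⟨ *-congˡ (balanced-sum vanishes) ⟩
      h * ((1# - t) + (1# - t))             ≈⟨ distribˡ h _ _ ⟩
      h * (1# - t) + h * (1# - t)           ≈⟨ distribʳ (1# - t) h h ⟨
      (h + h) * (1# - t)                    ≈⟨ *-congʳ h+h≈1 ⟩
      1# * (1# - t)                         ≈⟨ *-identityˡ (1# - t) ⟩
      1# - t                                ∎

module Walks (G : Graph) where
  open Graph G
  open import Data.Nat using (_+_)
  open import Data.Nat.Properties using (+-comm)
  open ≡ using (trans; cong)
  open ≡.≡-Reasoning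

  Joins-sym : ∀ {e u w} → Joins G e u w → Joins G e w u
  Joins-sym = swap

  _++_ : ∀ {u w v} → Walk G u w → Walk G w v → Walk G u v
  [ _ ]        ++ W₂ = W₂
  step e j W₁ ++ W₂ = step e j (W₁ ++ W₂)

  length-++ : ∀ {u w v} (W₁ : Walk G u w) (W₂ : Walk G w v) →
              length G (W₁ ++ W₂) ≡ length G W₁ + length G W₂
  length-++ [ _ ]         W₂ = refl
  length-++ (step e j W₁) W₂ = cong suc (length-++ W₁ W₂)

  isOdd-++ : ∀ {u w v} (W₁ : Walk G u w) (W₂ : Walk G w v) →
             isOdd (length G (W₁ ++ W₂)) ≡ isOdd (length G W₁) xor isOdd (length G W₂)
  isOdd-++ W₁ W₂ = trans (cong isOdd (length-++ W₁ W₂)) (isOdd-+ (length G W₁) (length G W₂))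

  reverse : ∀ {u v} → Walk G u v → Walk G v u
  reverse [ v ]              = [ v ]
  reverse (step {u} e j W) = reverse W ++ step e (Joins-sym j) [ u ]

  length-reverse : ∀ {u v} (W : Walk G u v) → length G (reverse W) ≡ length G W
  length-reverse [ _ ]            = refl
  length-reverse (step {u} e j W) = begin
    length G (reverse W ++ step e (Joins-sym j) [ u ]) ≡⟨ length-++ (reverse W) _ ⟩
    length G (reverse W) + 1                         ≡⟨ +-comm (length G (reverse W)) 1 ⟩
    suc (length G (reverse W))                       ≡⟨ cong suc (length-reverse W) ⟩
    suc (length G W)                                 ∎

  monochromatic-edge : ¬ Bipartite G → (colour : Fin nV → Bool) →
                       ∃[ e ] colour (end₁ e) ≡ colour (end₂ e)
  monochromatic-edge nonBipartite colour with
    ¬∀⟶∃¬ nE _ (λ e → ¬? (colour (end₁ e) ≟ colour (end₂ e))) (λ proper → nonBipartite (colour , proper))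
  ... | e , ¬¬same = e , decidable-stable (colour (end₁ e) ≟ colour (end₂ e)) ¬¬same

  odd-closed-walk : Connected G → ¬ Bipartite G → ∀ v → Σ[ O ∈ Walk G v v ] isOdd (length G O) ≡ true
  odd-closed-walk connected nonBipartite v with monochromatic-edge nonBipartite colour
    where
    colour : Fin nV → Bool
    colour u = isOdd (length G (connected v u))
  ... | e , same = O , odd
    where
    P : Walk G v (end₁ e)
    P = connected v (end₁ e)
    Q : Walk G v (end₂ e)
    Q = connected v (end₂ e)
    O : Walk G v v
    O = P ++ step e (inj₁ (refl , refl)) (reverse Q)
    b : Bool
    b = isOdd (length G Q)
    odd : isOdd (length G O) ≡ true
    odd = begin
      isOdd (length G O)                                        ≡⟨ isOdd-++ P _ ⟩
      isOdd (length G P) xor not (isOdd (length G (reverse Q))) ≡⟨ cong (λ n → isOdd (length G P) xor not (isOdd n)) (length-reverse Q) ⟩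
      isOdd (length G P) xor not b                              ≡⟨ cong (_xor not b) same ⟩
      b xor not b                                               ≡⟨ not-distribʳ-xor b b ⟨
      not (b xor b)                                             ≡⟨ cong not (xor-same b) ⟩
      true                                                      ∎

module _ (G : Graph) {c ℓ} (F : CharZeroField c ℓ) where
  open Graph G
  open Walks G
  open CharZeroField F renaming (refl to ≈-refl)
  open AbelianGroupLemmas +-abelianGroup
  open import Algebra.Properties.AbelianGroup +-abelianGroup using (⁻¹-involutive)
  open import Relation.Binary.Reasoning.Setoid setoid

  signed : Bool → Carrier → Carrier
  signed false z = z
  signed true  z = - z

  -‿signed : ∀ b z → - signed b z ≈ signed (not b) z
  -‿signed false z = ≈-refl
  -‿signed true  z = ⁻¹-involutive z

  ω-cong : ∀ {u v} (W : Walk G u v) {y y′ : Fin nE → Carrier} →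
           (∀ e → y e ≈ y′ e) → ω G F W y ≈ ω G F W y′
  ω-cong [ _ ]        y≈y′ = ≈-refl
  ω-cong (step e j W) y≈y′ = +-cong (y≈y′ e) (-‿cong (ω-cong W y≈y′))

  ω-++ : ∀ {u w v} (W₁ : Walk G u w) (W₂ : Walk G w v) y →
         ω G F (W₁ ++ W₂) y ≈ ω G F W₁ y + signed (isOdd (length G W₁)) (ω G F W₂ y)
  ω-++ [ _ ]         W₂ y = sym (+-identityˡ _)
  ω-++ (step e j W₁) W₂ y = begin
    y e - ω G F (W₁ ++ W₂) y                   ≈⟨ +-congˡ (-‿cong (ω-++ W₁ W₂ y)) ⟩
    y e - (ω G F W₁ y + signed b (ω G F W₂ y)) ≈⟨ x-[y+z]≈x-y-z _ _ _ ⟩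
    y e - ω G F W₁ y - signed b (ω G F W₂ y)   ≈⟨ +-congˡ (-‿signed b _) ⟩
    y e - ω G F W₁ y + signed (not b) (ω G F W₂ y) ∎
    where
    b : Bool
    b = isOdd (length G W₁)

  ω-++-odd : ∀ {u w v} (W₁ : Walk G u w) (W₂ : Walk G w v) y → isOdd (length G W₁) ≡ true →
             ω G F (W₁ ++ W₂) y ≈ ω G F W₁ y - ω G F W₂ y
  ω-++-odd W₁ W₂ y odd =
    ≡.subst (λ b → ω G F (W₁ ++ W₂) y ≈ ω G F W₁ y + signed b (ω G F W₂ y)) odd (ω-++ W₁ W₂ y)

  σ-Joins : ∀ x {e u w} → Joins G e u w → σ G F x e ≈ 1# - (x u + x w)
  σ-Joins x (inj₁ (refl , refl)) = ≈-refl
  σ-Joins x (inj₂ (refl , refl)) = +-congˡ (-‿cong (+-comm _ _))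

  σ-sub-σ : ∀ x {e e′ u w t} → Joins G e u w → Joins G e′ w t → σ G F x e - σ G F x e′ ≈ x t - x u
  σ-sub-σ x {e} {e′} {u} {w} {t} j j′ = begin
    σ G F x e - σ G F x e′                ≈⟨ +-cong (σ-Joins x j) (-‿cong (σ-Joins x j′)) ⟩
    1# - (x u + x w) - (1# - (x w + x t)) ≈⟨ [x-y]-[x-z]≈z-y 1# _ _ ⟩
    (x w + x t) - (x u + x w)             ≈⟨ [x+y]-[z+x]≈y-z (x w) (x t) (x u) ⟩
    x t - x u                             ∎

  ω-σ-even : ∀ x {u v} (W : Walk G u v) → isOdd (length G W) ≡ false → ω G F W (σ G F x) ≈ x v - x u
  ω-σ-even x [ v ]                       _    = sym (-‿inverseʳ (x v))
  ω-σ-even x {u} {v} (step e j (step {w = t} e′ j′ W)) even = begin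
    s e - (s e′ - ω G F W s) ≈⟨ x-[y-z]≈x-y+z _ _ _ ⟩
    (s e - s e′) + ω G F W s ≈⟨ +-cong (σ-sub-σ x j j′) (ω-σ-even x W (≡.trans (≡.sym (not-involutive _)) even)) ⟩
    (x t - x u) + (x v - x t) ≈⟨ [x-y]+[z-x]≈z-y (x t) (x u) (x v) ⟩
    x v - x u ∎
    where
    s : Fin nE → Carrier
    s = σ G F x

  image⇒evenClosedWalkCondition : ∀ y → InImageσ G F y → EvenClosedWalkCondition G F y
  image⇒evenClosedWalkCondition y (x , y≈σx) v W (k , even) = begin
    ω G F W y         ≈⟨ ω-cong W y≈σx ⟩
    ω G F W (σ G F x) ≈⟨ ω-σ-even x W (≡.trans (≡.cong isOdd even) (isOdd-double k)) ⟩
    x v - x v         ≈⟨ -‿inverseʳ (x v) ⟩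
    0#                ∎

  half : Σ[ h ∈ Carrier ] h + h ≈ 1#
  half with inverse (natCast cring 2) (charZero 1)
  ... | h , 2h≈1 = h , (begin
    h + h                  ≈⟨ +-cong (*-identityˡ h) (*-identityˡ h) ⟨
    1# * h + 1# * h        ≈⟨ distribʳ h 1# 1# ⟨
    (1# + 1#) * h          ≈⟨ *-congʳ (+-congˡ (+-identityʳ 1#)) ⟨
    natCast cring 2 * h    ≈⟨ 2h≈1 ⟩
    1#                     ∎)

  module _ (connected : Connected G) (nonBipartite : ¬ Bipartite G) (y : Fin nE → Carrier) where

    oddWalk : ∀ v → Walk G v v
    oddWalk v = proj₁ (odd-closed-walk connected nonBipartite v)

    oddWalk-odd : ∀ v → isOdd (length G (oddWalk v)) ≡ true
    oddWalk-odd v = proj₂ (odd-closed-walk connected nonBipartite v)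

    potential : Fin nV → Carrier
    potential v = proj₁ half * (1# - ω G F (oddWalk v) y)

    closedWalkThrough : ∀ e → Walk G (end₁ e) (end₁ e)
    closedWalkThrough e = oddWalk (end₁ e) ++ step e (inj₁ (refl , refl))
                            (oddWalk (end₂ e) ++ step e (inj₂ (refl , refl)) [ end₁ e ])

    closedWalkThrough-even : ∀ e → EvenWalk G (closedWalkThrough e)
    closedWalkThrough-even e = isOdd≡false⇒double _ parity
      where
      parity : isOdd (length G (closedWalkThrough e)) ≡ false
      parity rewrite isOdd-++ (oddWalk (end₁ e)) (step e (inj₁ (refl , refl))
                       (oddWalk (end₂ e) ++ step e (inj₂ (refl , refl)) [ end₁ e ]))
                   | isOdd-++ (oddWalk (end₂ e)) (step e (inj₂ (refl , refl)) [ end₁ e ])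
                   | oddWalk-odd (end₁ e) | oddWalk-odd (end₂ e) = refl

    ω-closedWalkThrough : ∀ e → ω G F (closedWalkThrough e) y ≈
      (ω G F (oddWalk (end₁ e)) y - y e) + (ω G F (oddWalk (end₂ e)) y - y e)
    ω-closedWalkThrough e = begin
      ω G F (closedWalkThrough e) y    ≈⟨ ω-++-odd (oddWalk a) _ y (oddWalk-odd a) ⟩
      A - (y e - ω G F (oddWalk b ++ step e (inj₂ (refl , refl)) [ a ]) y)
                                       ≈⟨ +-congˡ (-‿cong (+-congˡ (-‿cong (ω-++-odd (oddWalk b) _ y (oddWalk-odd b))))) ⟩
      A - (y e - (B - (y e - 0#)))     ≈⟨ +-congˡ (-‿cong (+-congˡ (-‿cong (+-congˡ (-‿cong (x-0≈x (y e))))))) ⟩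
      A - (y e - (B - y e))            ≈⟨ x-[y-z]≈x-y+z A (y e) (B - y e) ⟩
      (A - y e) + (B - y e)            ∎
      where
      a b : Fin nV
      a = end₁ e
      b = end₂ e
      A B : Carrier
      A = ω G F (oddWalk a) y
      B = ω G F (oddWalk b) y

    evenClosedWalkCondition⇒image : EvenClosedWalkCondition G F y → InImageσ G F y
    evenClosedWalkCondition⇒image condition = potential , λ e → sym
      (RingLemmas.halving ring (proj₂ half)
        (trans (sym (ω-closedWalkThrough e))
               (condition (end₁ e) (closedWalkThrough e) (closedWalkThrough-even e))))

lemma6p4 : ∀ {c ℓ : Level} (F : CharZeroField c ℓ) (G : Graph) →
    Connected G → ¬ Bipartite G →
    ∀ (y : Fin (Graph.nE G) → CharZeroField.Carrier F) →
      InImageσ G F y ⇔ EvenClosedWalkCondition G F y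
lemma6p4 F G connected nonBipartite y =
  mk⇔ (image⇒evenClosedWalkCondition G F y)
      (evenClosedWalkCondition⇒image G F connected nonBipartite y)
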